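{- Let $d\ge 1$ be an integer and let $G$ be a connected bipartite graph with $|V(G)|\ge 2d+2$ and $\alpha(G)\ge d+1$. Then there is a set $S\subseteq E(G)$ with $|S|\le 2d+1$ such that $\alpha(G/S)\le \alpha(G)-d$.
   Context: All graphs are finite and simple. $\alpha$ denotes the independence number. For $S\subseteq E(G)$, let $G|_S$ be the graph with vertex set $V(G)$ and edge set $S$; the contraction $G/S$ is the graph whose vertices correspond to the connected components of $G|_S$, two vertices being adjacent iff the corresponding components $A,B$ satisfy $\mathrm{dist}_G(V(A),V(B))=1$. -}

module Defs where

open import Data.Nat using (ℕ; _≤_; _+_; _*_; _∸_)
open import Data.Fin using (Fin)
open import Data.Bool using (Bool; true; false)
open import Data.Product using (Σ; _×_; _,_; ∃)
open import Data.Sum using (_⊎_)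
open import Data.List using (List; length)
open import Data.List.Membership.Propositional using (_∈_)
open import Data.List.Relation.Unary.All using (All)
open import Data.List.Relation.Unary.AllPairs using (AllPairs)
open import Data.List.Relation.Unary.Unique.Propositional using (Unique)
open import Relation.Binary.PropositionalEquality using (_≡_; _≢_)
open import Relation.Nullary using (¬_)

record Graph (n : ℕ) : Set where
  field
    adj    : Fin n → Fin n → Bool
    sym    : ∀ u v → adj u v ≡ adj v u
    irrefl : ∀ u → adj u u ≡ false
open Graph public

module _ {n : ℕ} (G : Graph n) where

  Adj : Fin n → Fin n → Set
  Adj u v = adj G u v ≡ true

  data Path : Fin n → Fin n → Set where
    here : ∀ {u} → Path u u
    step : ∀ {u v w} → Path u v → Adj v w → Path u w

  Connected : Set
  Connected = ∀ u v → Path u v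

  Bipartite : Set
  Bipartite = Σ (Fin n → Bool) λ c → ∀ u v → Adj u v → c u ≢ c v

  IsIndependent : List (Fin n) → Set
  IsIndependent I = Unique I × AllPairs (λ u v → ¬ Adj u v) I

  IsIndepNum : ℕ → Set
  IsIndepNum a = (Σ (List (Fin n)) λ I → IsIndependent I × length I ≡ a)
               × (∀ I → IsIndependent I → length I ≤ a)

  EdgeList : Set
  EdgeList = List (Fin n × Fin n)

  IsEdgeSet : EdgeList → Set
  IsEdgeSet S = All (λ e → Adj (Data.Product.proj₁ e) (Data.Product.proj₂ e)) S

  data SameComp (S : EdgeList) : Fin n → Fin n → Set where
    here : ∀ {u} → SameComp S u u
    step : ∀ {u v w} → SameComp S u v → ((v , w) ∈ S ⊎ (w , v) ∈ S) → SameComp S u w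

  -- adjacency in G/S between the components containing x and y:
  -- the components are distinct and at distance 1 in G
  ContrAdj : EdgeList → Fin n → Fin n → Set
  ContrAdj S x y = ¬ SameComp S x y
                 × ∃ λ u → ∃ λ v → SameComp S x u × SameComp S y v × Adj u v

  -- independent set of G/S, components represented by vertices of G:
  -- representatives lie in pairwise distinct components, pairwise nonadjacent in G/S
  IsContrIndependent : EdgeList → List (Fin n) → Set
  IsContrIndependent S I =
    AllPairs (λ x y → ¬ SameComp S x y × ¬ ContrAdj S x y) I

  ContrIndepNum≤ : EdgeList → ℕ → Set
  ContrIndepNum≤ S k = ∀ I → IsContrIndependent S I → length I ≤ k

-- By König's theorem the bipartite graph G has a matching M with |M| ≥ n − α(G); it is
-- obtained by augmenting along alternating paths until the set Z of vertices reachable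
-- from free X-vertices yields the vertex cover (X ∖ Z) ∪ (Y ∩ Z).  Grow from a root a
-- connected vertex set T that is closed under M, with |T| ∈ {2d+1, 2d+2}, and let S be
-- the edges of a spanning tree of T.  In G/S all of T is one vertex, so an independent set
-- I of G/S has at most one vertex in T, and the rest J is independent in G − T.  Every
-- matching edge outside T has an end outside J, so |J| ≤ n − |T| − |M ∖ M[T]|, while
-- |M[T]| ≤ |T|/2; with |M| ≥ n − α this gives |J| ≤ α − ⌈|T|/2⌉ ≤ α − d − 1.
module Submission where

open import Defs renaming (sym to adj-symmetric; irrefl to adj-irreflexive)
open import Data.Nat using (ℕ; zero; suc; _≤_; _<_; _+_; _*_; _∸_; z≤n; s≤s)
open import Data.Nat.Properties
open import Data.Nat.Tactic.RingSolver using (solve-∀)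
open import Data.Bool using (Bool; true; false; not; _∧_; _∨_; if_then_else_)
open import Data.Bool.Properties using (¬-not; ∨-zeroʳ) renaming (_≟_ to _≟ᵇ_)
open import Data.Fin using (Fin) renaming (_≟_ to _≟ᶠ_)
open import Data.Fin.Properties using (any?)
open import Data.Maybe using (Maybe; just; nothing; is-just; is-nothing; fromMaybe)
open import Data.Maybe.Properties using (just-injective) renaming (≡-dec to ≡-decᵐ)
open import Data.Product using (Σ; ∃; ∃₂; _×_; _,_; proj₁; proj₂)
open import Data.Sum using (_⊎_; inj₁; inj₂; [_,_]; swap)
open import Data.List using (List; []; _∷_; length; map; filter; allFin; _++_)
open import Data.List.Properties
  using (length-map; length-++; length-filter; filter-none; filter-notAll; length-tabulate)
open import Data.List.Membership.Propositional using (_∈_; _∉_)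
open import Data.List.Membership.Propositional.Properties
  using (∈-filter⁺; ∈-filter⁻; ∈-map⁻; ∈-allFin; ∈-++⁻)
open import Data.List.Relation.Unary.Any as Any using (here; there)
open import Data.List.Relation.Unary.All as All using (All; []; _∷_)
open import Data.List.Relation.Unary.AllPairs as AllPairs using (AllPairs; []; _∷_)
import Data.List.Relation.Unary.AllPairs.Properties as AllPairsₚ
open import Data.List.Relation.Unary.Unique.Propositional using (Unique)
import Data.List.Relation.Unary.Unique.Propositional.Properties as Uniqueₚ
open import Data.List.Relation.Binary.Subset.Propositional using (_⊆_)
open import Function using (_∘_; const; case_of_)
open import Data.Vec.Functional using (updateAt)
open import Data.Vec.Functional.Properties using (updateAt-updates; updateAt-minimal)
open import Level using (Level)
open import Relation.Nullary using (¬_; Dec; yes; no; does; contradiction)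
open import Relation.Nullary.Decidable using (¬?; _×-dec_; dec-true; decidable-stable)
open import Relation.Unary using (Pred; Decidable)
open import Relation.Binary using (Rel; DecidableEquality)
open import Relation.Binary.PropositionalEquality hiding ([_])

private variable ℓ : Level

module _ {A : Set} where

  AllPairs-∈⁺ : ∀ {R : Rel A ℓ} {xs} → Unique xs →
    (∀ {x y} → x ∈ xs → y ∈ xs → x ≢ y → R x y) → AllPairs R xs
  AllPairs-∈⁺ [] h = []
  AllPairs-∈⁺ (x∉ ∷ u) h =
    All.tabulate (λ y∈ → h (here refl) (there y∈) (All.lookup x∉ y∈))
      ∷ AllPairs-∈⁺ u (λ p q → h (there p) (there q))

  Unique-map⁺ : ∀ {B : Set} (f : A → B) {xs} → Unique xs →
    (∀ {x y} → x ∈ xs → y ∈ xs → f x ≡ f y → x ≡ y) → Unique (map f xs)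
  Unique-map⁺ f u inj = AllPairsₚ.map⁺ (AllPairs-∈⁺ u (λ p q x≢y → x≢y ∘ inj p q))

  length-filter-∁ : ∀ {P : Pred A ℓ} (P? : Decidable P) xs →
    length (filter P? xs) + length (filter (¬? ∘ P?) xs) ≡ length xs
  length-filter-∁ P? [] = refl
  length-filter-∁ P? (x ∷ xs) with P? x
  ... | yes _ = cong suc (length-filter-∁ P? xs)
  ... | no _  = trans (+-suc _ _) (cong suc (length-filter-∁ P? xs))

  length-filter≤1 : ∀ {R : Rel A ℓ} {P : Pred A ℓ} (P? : Decidable P) →
    (∀ {x y} → P x → P y → ¬ R x y) → ∀ {xs} → AllPairs R xs → length (filter P? xs) ≤ 1
  length-filter≤1 P? ¬R [] = z≤n
  length-filter≤1 P? ¬R {x ∷ xs} (Rx ∷ Rxs) with P? x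
  ... | no _ = length-filter≤1 P? ¬R Rxs
  ... | yes px rewrite filter-none P? (All.map (λ Rxy py → ¬R px py Rxy) Rx) = s≤s z≤n

module _ {A : Set} (_≟_ : DecidableEquality A) where

  Unique⇒length≤ : ∀ {xs ys} → Unique xs → xs ⊆ ys → length xs ≤ length ys
  Unique⇒length≤ [] _ = z≤n
  Unique⇒length≤ {x ∷ xs} {ys} (x∉ ∷ u) sub =
    ≤-trans (s≤s (Unique⇒length≤ u sub′))
            (filter-notAll x≢? ys (Any.map (λ x≡ x≢ → x≢ (sym x≡)) (sub (here refl))))
    where
    x≢? = λ y → ¬? (y ≟ x)
    sub′ : xs ⊆ filter x≢? ys
    sub′ y∈ = ∈-filter⁺ x≢? (sub (there y∈)) (λ y≡x → All.lookup x∉ y∈ (sym y≡x))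

  Unique⇒length≡ : ∀ {xs ys} → Unique xs → Unique ys →
    xs ⊆ ys → ys ⊆ xs → length xs ≡ length ys
  Unique⇒length≡ uxs uys xs⊆ys ys⊆xs =
    ≤-antisym (Unique⇒length≤ uxs xs⊆ys) (Unique⇒length≤ uys ys⊆xs)

module _ {A B : Set} (_≟_ : DecidableEquality B) where

  length≤-injection : ∀ (f : A → B) {xs ys} → Unique xs → (∀ {x} → x ∈ xs → f x ∈ ys) →
    (∀ {x y} → x ∈ xs → y ∈ xs → f x ≡ f y → x ≡ y) → length xs ≤ length ys
  length≤-injection f {xs} u into inj =
    subst (_≤ _) (length-map f xs) (Unique⇒length≤ _≟_ (Unique-map⁺ f u inj) map⊆)
    where
    map⊆ : map f xs ⊆ _
    map⊆ y∈ with x , x∈ , refl ← ∈-map⁻ f y∈ = into x∈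

-- Subsets of Fin n as Boolean functions

module _ {n : ℕ} where

  elements : (Fin n → Bool) → List (Fin n)
  elements f = filter (λ v → f v ≟ᵇ true) (allFin n)

  ∣_∣ : (Fin n → Bool) → ℕ
  ∣ f ∣ = length (elements f)

  elements-unique : ∀ f → Unique (elements f)
  elements-unique f = Uniqueₚ.filter⁺ _ (Uniqueₚ.allFin⁺ n)

  ∈-elements⁺ : ∀ {f v} → f v ≡ true → v ∈ elements f
  ∈-elements⁺ {v = v} fv = ∈-filter⁺ _ (∈-allFin v) fv

  ∈-elements⁻ : ∀ {f v} → v ∈ elements f → f v ≡ true
  ∈-elements⁻ {f} v∈ = proj₂ (∈-filter⁻ (λ v → f v ≟ᵇ true) {xs = allFin n} v∈)

  ∷-elements-unique : ∀ {f p} → f p ≢ true → Unique (p ∷ elements f)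
  ∷-elements-unique {f} fp =
    All.tabulate (λ v∈ p≡v → fp (subst (λ w → f w ≡ true) (sym p≡v) (∈-elements⁻ v∈)))
      ∷ elements-unique f

  ∣∣≤n : ∀ f → ∣ f ∣ ≤ n
  ∣∣≤n f = ≤-trans (length-filter _ (allFin n)) (≤-reflexive (length-tabulate _))

  ∣∣-strict : ∀ {f g p} → (∀ {v} → f v ≡ true → g v ≡ true) →
    f p ≢ true → g p ≡ true → ∣ f ∣ < ∣ g ∣
  ∣∣-strict f⊆g fp gp = Unique⇒length≤ _≟ᶠ_ (∷-elements-unique fp)
    (λ { (here refl) → ∈-elements⁺ gp ; (there v∈) → ∈-elements⁺ (f⊆g (∈-elements⁻ v∈)) })

  ∣∣-insert : ∀ {f g p} → (∀ {v} → v ≢ p → f v ≡ g v) →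
    f p ≢ true → g p ≡ true → ∣ g ∣ ≡ suc ∣ f ∣
  ∣∣-insert {f} {g} {p} f≈g fp gp =
    Unique⇒length≡ _≟ᶠ_ (elements-unique g) (∷-elements-unique fp) g⊆ ⊆g
    where
    g⊆ : elements g ⊆ p ∷ elements f
    g⊆ {v} v∈ with v ≟ᶠ p
    ... | yes refl = here refl
    ... | no v≢p = there (∈-elements⁺ (trans (f≈g v≢p) (∈-elements⁻ v∈)))
    ⊆g : p ∷ elements f ⊆ elements g
    ⊆g (here refl) = ∈-elements⁺ gp
    ⊆g (there v∈) =
      ∈-elements⁺ (trans (sym (f≈g λ { refl → fp (∈-elements⁻ v∈) })) (∈-elements⁻ v∈))

  stabilises : (Z : ℕ → Fin n → Bool) → (∀ {k v} → Z k v ≡ true → Z (suc k) v ≡ true) →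
    ∃ λ j → ∀ {v} → Z (suc j) v ≡ true → Z j v ≡ true
  stabilises Z inflationary with chain (suc n)
    where
    chain : ∀ k → (∃ λ j → ∀ {v} → Z (suc j) v ≡ true → Z j v ≡ true) ⊎ k ≤ ∣ Z k ∣
    chain zero = inj₂ z≤n
    chain (suc k) with chain k
    ... | inj₁ stable = inj₁ stable
    ... | inj₂ k≤ with any? (λ v → (Z (suc k) v ≟ᵇ true) ×-dec ¬? (Z k v ≟ᵇ true))
    ...   | yes (_ , new , ¬old) = inj₂ (≤-trans (s≤s k≤) (∣∣-strict inflationary ¬old new))
    ...   | no none =
      inj₁ (k , λ {v} new → decidable-stable (Z k v ≟ᵇ true) (λ ¬old → none (v , new , ¬old)))
  ... | inj₁ stable = stable
  ... | inj₂ n<∣Z∣ = contradiction (∣∣≤n (Z (suc n))) (<⇒≱ n<∣Z∣)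

half-sum< : ∀ x y {t} → x + x ≤ t → suc (y + y) ≤ t → y + x < t
half-sum< x y 2x≤t 2y<t with x ≤? y
... | yes x≤y = ≤-trans (s≤s (+-monoʳ-≤ y x≤y)) 2y<t
... | no x≰y = ≤-trans (+-monoˡ-< x (≰⇒> x≰y)) 2x≤t

module _ {n : ℕ} (G : Graph n) where

  open import Data.List.Membership.DecPropositional (_≟ᶠ_ {n}) using (_∈?_)

  Adj-sym : ∀ {u v} → Adj G u v → Adj G v u
  Adj-sym {u} {v} = trans (adj-symmetric G v u)

  Adj-irrefl : ∀ {u v} → Adj G u v → u ≢ v
  Adj-irrefl {u} a refl with trans (sym a) (adj-irreflexive G u)
  ... | ()

  SameComp-trans : ∀ {S x y z} → SameComp G S x y → SameComp G S y z → SameComp G S x z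
  SameComp-trans p here = p
  SameComp-trans p (step q e) = step (SameComp-trans p q) e

  SameComp-sym : ∀ {S x y} → SameComp G S x y → SameComp G S y x
  SameComp-sym here = here
  SameComp-sym (step p (inj₁ e)) = SameComp-trans (step here (inj₂ e)) (SameComp-sym p)
  SameComp-sym (step p (inj₂ e)) = SameComp-trans (step here (inj₁ e)) (SameComp-sym p)

  SameComp-mono : ∀ {S S′ x y} → S ⊆ S′ → SameComp G S x y → SameComp G S′ x y
  SameComp-mono sub here = here
  SameComp-mono sub (step p (inj₁ e)) = step (SameComp-mono sub p) (inj₁ (sub e))
  SameComp-mono sub (step p (inj₂ e)) = step (SameComp-mono sub p) (inj₂ (sub e))

  record Matching : Set where
    field
      mate     : Fin n → Maybe (Fin n)
      mate-sym : ∀ {u v} → mate u ≡ just v → mate v ≡ just u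
      mate-adj : ∀ {u v} → mate u ≡ just v → Adj G u v

  open Matching public

  empty : Matching
  empty = record { mate = const nothing ; mate-sym = λ () ; mate-adj = λ () }

  Closed : Matching → List (Fin n) → Set
  Closed M T = ∀ {x y} → x ∈ T → mate M x ≡ just y → y ∈ T

  mate-irrefl : ∀ M {x y} → mate M x ≡ just y → x ≢ y
  mate-irrefl M = Adj-irrefl ∘ mate-adj M

  mate-injective : ∀ M {x x′ y} → mate M x ≡ just y → mate M x′ ≡ just y → x ≡ x′
  mate-injective M mx mx′ = just-injective (trans (sym (mate-sym M mx)) (mate-sym M mx′))

  partner : Matching → Fin n → Fin n
  partner M v = fromMaybe v (mate M v)

  mate-partner : ∀ M {v} → mate M v ≢ nothing → mate M v ≡ just (partner M v)
  mate-partner M {v} mv with mate M v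
  ... | nothing = contradiction refl mv
  ... | just _  = refl

  partner-injective : ∀ M {x y} → mate M x ≡ just (partner M x) → mate M y ≡ just (partner M y) →
    partner M x ≡ partner M y → x ≡ y
  partner-injective M mx my px≡py =
    mate-injective M mx (subst (λ p → mate M _ ≡ just p) (sym px≡py) my)

  redirect : (Fin n → Maybe (Fin n)) → Fin n → Maybe (Fin n) → Fin n → Maybe (Fin n) →
    Fin n → Maybe (Fin n)
  redirect m x a y b = updateAt (updateAt m x (const a)) y (const b)

  module _ {m : Fin n → Maybe (Fin n)} {x y : Fin n} {a b : Maybe (Fin n)} where

    redirect-x : x ≢ y → redirect m x a y b x ≡ a
    redirect-x x≢y = trans (updateAt-minimal x y _ x≢y) (updateAt-updates x m)

    redirect-y : redirect m x a y b y ≡ b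
    redirect-y = updateAt-updates y _

    redirect-other : ∀ {v} → v ≢ x → v ≢ y → redirect m x a y b v ≡ m v
    redirect-other v≢x v≢y = trans (updateAt-minimal _ y _ v≢y) (updateAt-minimal _ x m v≢x)

  unmatch : ∀ M {x y} → mate M x ≡ just y → Matching
  unmatch M {x} {y} mx =
    record { mate = m′ ; mate-sym = m′-sym ; mate-adj = mate-adj M ∘ proj₂ ∘ proj₂ ∘ untouched }
    where
    m′ = redirect (mate M) x nothing y nothing
    x≢y = mate-irrefl M mx

    untouched : ∀ {u w} → m′ u ≡ just w → u ≢ x × u ≢ y × mate M u ≡ just w
    untouched {u} m′u with u ≟ᶠ x | u ≟ᶠ y
    ... | yes refl | _ with () ← trans (sym (redirect-x x≢y)) m′u
    ... | no _ | yes refl with () ← trans (sym redirect-y) m′u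
    ... | no u≢x | no u≢y = u≢x , u≢y , trans (sym (redirect-other u≢x u≢y)) m′u

    m′-sym : ∀ {u w} → m′ u ≡ just w → m′ w ≡ just u
    m′-sym m′u with u≢x , u≢y , mu ← untouched m′u =
      trans (redirect-other (λ { refl → u≢y (just-injective (trans (sym (mate-sym M mu)) mx)) })
                            (λ { refl → u≢x (just-injective (trans (sym (mate-sym M mu)) (mate-sym M mx))) }))
            (mate-sym M mu)

  match : ∀ M {x y} → mate M x ≡ nothing → mate M y ≡ nothing → Adj G x y → Matching
  match M {x} {y} fx fy xy = record { mate = m′ ; mate-sym = m′-sym ; mate-adj = m′-adj }
    where
    m′ = redirect (mate M) x (just y) y (just x)
    x≢y = Adj-irrefl xy

    m′-sym : ∀ {u w} → m′ u ≡ just w → m′ w ≡ just u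
    m′-sym {u} m′u with u ≟ᶠ x | u ≟ᶠ y
    ... | yes refl | _ with refl ← just-injective (trans (sym (redirect-x x≢y)) m′u) = redirect-y
    ... | no _ | yes refl with refl ← just-injective (trans (sym redirect-y) m′u) = redirect-x x≢y
    ... | no u≢x | no u≢y =
      trans (redirect-other (matched≢ fx) (matched≢ fy)) (mate-sym M mu)
      where
      mu = trans (sym (redirect-other u≢x u≢y)) m′u
      matched≢ : ∀ {v} → mate M v ≡ nothing → _ ≢ v
      matched≢ fv refl with () ← trans (sym fv) (mate-sym M mu)

    m′-adj : ∀ {u w} → m′ u ≡ just w → Adj G u w
    m′-adj {u} m′u with u ≟ᶠ x | u ≟ᶠ y
    ... | yes refl | _ with refl ← just-injective (trans (sym (redirect-x x≢y)) m′u) = xy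
    ... | no _ | yes refl with refl ← just-injective (trans (sym redirect-y) m′u) = Adj-sym xy
    ... | no u≢x | no u≢y = mate-adj M (trans (sym (redirect-other u≢x u≢y)) m′u)

  -- Connected vertex sets closed under a matching

  Path-exit : ∀ {T r w} → Path G r w → r ∈ T → w ∉ T →
    ∃₂ λ u v → u ∈ T × v ∉ T × Adj G u v
  Path-exit here r∈ w∉ = contradiction r∈ w∉
  Path-exit {T} (step {v = v} {w = w} p vw) r∈ w∉ with v ∈? T
  ... | yes v∈ = v , w , v∈ , w∉ , vw
  ... | no v∉ = Path-exit p r∈ v∉

  ∃∉ : ∀ T → length T < n → ∃ λ w → w ∉ T
  ∃∉ T |T|<n with any? (λ w → ¬? (w ∈? T))
  ... | yes w∉ = w∉
  ... | no ¬w∉ = contradiction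
    (Unique⇒length≤ _≟ᶠ_ (Uniqueₚ.allFin⁺ n) λ {w} _ → decidable-stable (w ∈? T) (¬w∉ ∘ (w ,_)))
    (<⇒≱ (subst (length T <_) (sym (length-tabulate _)) |T|<n))

  record RootedTree (r : Fin n) : Set where
    field
      vertices    : List (Fin n)
      edges       : EdgeList G
      unique      : Unique vertices
      root        : r ∈ vertices
      spans       : ∀ {v} → v ∈ vertices → SameComp G edges r v
      edges-valid : IsEdgeSet G edges
      edge-count  : suc (length edges) ≡ length vertices

  open RootedTree public

  edges≤ : ∀ {r m} (t : RootedTree r) → length (vertices t) ≤ suc m → length (edges t) ≤ m
  edges≤ t |T|≤ = ≤-pred (subst (_≤ _) (sym (edge-count t)) |T|≤)

  singleton : ∀ r → RootedTree r
  singleton r = record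
    { vertices = r ∷ [] ; edges = [] ; unique = [] ∷ [] ; root = here refl
    ; spans = λ { (here refl) → here } ; edges-valid = [] ; edge-count = refl }

  attach : ∀ {r u v} (t : RootedTree r) → u ∈ vertices t → v ∉ vertices t → Adj G u v →
    RootedTree r
  attach {u = u} {v} t u∈ v∉ uv = record
    { vertices = v ∷ vertices t ; edges = (u , v) ∷ edges t
    ; unique = All.tabulate (λ w∈ v≡w → v∉ (subst (_∈ vertices t) (sym v≡w) w∈)) ∷ unique t
    ; root = there (root t)
    ; spans = λ { (here refl) → step (SameComp-mono there (spans t u∈)) (inj₁ (here refl))
                ; (there w∈) → SameComp-mono there (spans t w∈) }
    ; edges-valid = uv ∷ edges-valid t
    ; edge-count = cong suc (edge-count t) }

  module _ (M : Matching) where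

    saturate : ∀ {r v} (t : RootedTree r) → v ∈ vertices t →
      (∀ {x y} → x ∈ vertices t → x ≢ v → mate M x ≡ just y → y ∈ vertices t) →
      (∀ {w} → mate M v ≡ just w → w ∉ vertices t) →
      Σ (RootedTree r) λ t′ → Closed M (vertices t′) ×
        length (vertices t) ≤ length (vertices t′) × length (vertices t′) ≤ suc (length (vertices t))
    saturate {v = v} t v∈ closed-except mate∉ with mate M v in mv
    ... | nothing = t , closed , ≤-refl , n≤1+n _
      where
      closed : Closed M (vertices t)
      closed {x} x∈ mx with x ≟ᶠ v
      ... | yes refl with () ← trans (sym mv) mx
      ... | no x≢v = closed-except x∈ x≢v mx
    ... | just w = attach t v∈ (mate∉ refl) (mate-adj M mv) , closed , n≤1+n _ , ≤-refl
      where
      closed : Closed M (w ∷ vertices t)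
      closed (here refl) mx =
        there (subst (_∈ vertices t) (just-injective (trans (sym (mate-sym M mv)) mx)) v∈)
      closed {x} (there x∈) mx with x ≟ᶠ v
      ... | yes refl = here (just-injective (trans (sym mx) mv))
      ... | no x≢v = there (closed-except x∈ x≢v mx)

    attach-closed : ∀ {r u v} (t : RootedTree r) → Closed M (vertices t) →
      u ∈ vertices t → v ∉ vertices t → Adj G u v →
      Σ (RootedTree r) λ t′ → Closed M (vertices t′) ×
        length (vertices t) < length (vertices t′) × length (vertices t′) ≤ 2 + length (vertices t)
    attach-closed {v = v} t closed u∈ v∉ uv =
      saturate (attach t u∈ v∉ uv) (here refl) closed-except mate∉
      where
      closed-except : ∀ {x y} → x ∈ v ∷ vertices t → x ≢ v →
        mate M x ≡ just y → y ∈ v ∷ vertices t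
      closed-except (here refl) x≢v = contradiction refl x≢v
      closed-except (there x∈) _ mx = there (closed x∈ mx)
      mate∉ : ∀ {y} → mate M v ≡ just y → y ∉ v ∷ vertices t
      mate∉ mv (here refl) = mate-irrefl M mv refl
      mate∉ mv (there y∈) = v∉ (closed y∈ (mate-sym M mv))

    extend : Connected G → ∀ {r} (t : RootedTree r) → Closed M (vertices t) →
      length (vertices t) < n →
      Σ (RootedTree r) λ t′ → Closed M (vertices t′) ×
        length (vertices t) < length (vertices t′) × length (vertices t′) ≤ 2 + length (vertices t)
    extend conn {r} t closed |t|<n
      with w , w∉ ← ∃∉ (vertices t) |t|<n
      with u , v , u∈ , v∉ , uv ← Path-exit (conn r w) (root t) w∉
      = attach-closed t closed u∈ v∉ uv

    grow : Connected G → ∀ r k → suc k ≤ n →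
      Σ (RootedTree r) λ t → Closed M (vertices t) ×
        suc k ≤ length (vertices t) × length (vertices t) ≤ 2 + k
    grow conn r zero _ = saturate (singleton r) (here refl) closed-except mate∉
      where
      closed-except : ∀ {x y} → x ∈ r ∷ [] → x ≢ r → mate M x ≡ just y → y ∈ r ∷ []
      closed-except (here refl) x≢r = contradiction refl x≢r
      mate∉ : ∀ {y} → mate M r ≡ just y → y ∉ r ∷ []
      mate∉ mr (here refl) = mate-irrefl M mr refl
    grow conn r (suc k) k+2≤n with t , closed , lo , hi ← grow conn r k (≤-trans (n≤1+n _) k+2≤n)
      with m≤n⇒m<n∨m≡n lo
    ... | inj₁ k+1<|t| = t , closed , k+1<|t| , ≤-trans hi (n≤1+n _)
    ... | inj₂ k+1≡|t| rewrite k+1≡|t| = extend conn t closed k+2≤n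

  independent-∈ : ∀ {J u v} → IsIndependent G J → u ∈ J → v ∈ J → ¬ Adj G u v
  independent-∈ (_ , _ ∷ _) (here refl) (here refl) uv = Adj-irrefl uv refl
  independent-∈ (_ , ¬adj ∷ _) (here refl) (there v∈) = All.lookup ¬adj v∈
  independent-∈ (_ , ¬adj ∷ _) (there u∈) (here refl) = All.lookup ¬adj u∈ ∘ Adj-sym
  independent-∈ (_ ∷ distinct , _ ∷ ¬adj) (there u∈) (there v∈) =
    independent-∈ (distinct , ¬adj) u∈ v∈

  ContrIndependent⇒Independent : ∀ {S I} → IsContrIndependent G S I → IsIndependent G I
  ContrIndependent⇒Independent I-indep =
    AllPairs.map (λ { (¬same , _) refl → ¬same here }) I-indep ,
    AllPairs.map (λ (¬same , ¬contr) xy → ¬contr (¬same , _ , _ , here , here , xy)) I-indep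

  ContrIndependent-component : ∀ {S I T} → IsContrIndependent G S I →
    (∀ {x y} → x ∈ T → y ∈ T → SameComp G S x y) →
    length I ≤ suc (length (filter (λ v → ¬? (v ∈? T)) I))
  ContrIndependent-component {I = I} {T} I-indep connected = begin
    length I                                 ≡⟨ length-filter-∁ (_∈? T) I ⟨
    length (filter (_∈? T) I) + length I∖T   ≤⟨ +-monoˡ-≤ (length I∖T) at-most-one ⟩
    suc (length I∖T)                         ∎
    where
    open ≤-Reasoning
    I∖T = filter (λ v → ¬? (v ∈? T)) I
    at-most-one : length (filter (_∈? T) I) ≤ 1
    at-most-one = length-filter≤1 (_∈? T) (λ x∈ y∈ (¬same , _) → ¬same (connected x∈ y∈)) I-indep

  -- König's theorem

  module Bipartite (c : Fin n → Bool) (proper : ∀ u v → Adj G u v → c u ≢ c v) where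

    -- X = {v | c v ≡ true} and Y = {v | c v ≡ false}; size M = |M| since every matching
    -- edge has exactly one end in X.

    colour-flip : ∀ {u v} → Adj G u v → c v ≡ not (c u)
    colour-flip uv = ¬-not (proper _ _ uv ∘ sym)

    X⇒Y : ∀ {u v} → c u ≡ true → Adj G u v → c v ≡ false
    X⇒Y cu uv = trans (colour-flip uv) (cong not cu)

    Y⇒X : ∀ {u v} → c u ≡ false → Adj G u v → c v ≡ true
    Y⇒X cu uv = trans (colour-flip uv) (cong not cu)

    matchedX : Matching → Fin n → Bool
    matchedX M v = c v ∧ is-just (mate M v)

    size : Matching → ℕ
    size M = ∣ matchedX M ∣

    matchedX⁺ : ∀ M {v w} → c v ≡ true → mate M v ≡ just w → matchedX M v ≡ true
    matchedX⁺ M cv mv rewrite cv | mv = refl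

    matchedX⁻ : ∀ M {v} → matchedX M v ≡ true → c v ≡ true × mate M v ≡ just (partner M v)
    matchedX⁻ M {v} m with c v | mate M v
    ... | true | just _ = refl , refl

    X≢partner : ∀ M {v x} → c v ≡ true → c x ≡ true → mate M x ≡ just (partner M x) →
      v ≢ partner M x
    X≢partner M cv cx mx refl with () ← trans (sym cv) (X⇒Y cx (mate-adj M mx))

    private
      matchedX-free : ∀ M {v} → mate M v ≡ nothing → matchedX M v ≢ true
      matchedX-free M {v} mv rewrite mv with c v
      ... | true = λ ()
      ... | false = λ ()

      matchedX-cong : ∀ M M′ {v} → mate M v ≡ mate M′ v → matchedX M v ≡ matchedX M′ v
      matchedX-cong M M′ {v} = cong (λ m → c v ∧ is-just m)

      matchedX-Y : ∀ M M′ {v} → c v ≡ false → matchedX M v ≡ matchedX M′ v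
      matchedX-Y M M′ cv rewrite cv = refl

    size-unmatch : ∀ M {x y} (mx : mate M x ≡ just y) → c x ≡ true →
      size M ≡ suc (size (unmatch M mx))
    size-unmatch M {x} {y} mx cx =
      ∣∣-insert agree (matchedX-free (unmatch M mx) (redirect-x x≢y)) (matchedX⁺ M cx mx)
      where
      x≢y = mate-irrefl M mx
      agree : ∀ {v} → v ≢ x → matchedX (unmatch M mx) v ≡ matchedX M v
      agree {v} v≢x with v ≟ᶠ y
      ... | yes refl = matchedX-Y (unmatch M mx) M (X⇒Y cx (mate-adj M mx))
      ... | no v≢y = matchedX-cong (unmatch M mx) M (redirect-other v≢x v≢y)

    size-match : ∀ M {x y} (fx : mate M x ≡ nothing) (fy : mate M y ≡ nothing) (xy : Adj G x y) →
      c x ≡ true → size (match M fx fy xy) ≡ suc (size M)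
    size-match M {x} {y} fx fy xy cx =
      ∣∣-insert agree (matchedX-free M fx) (matchedX⁺ (match M fx fy xy) cx (redirect-x (Adj-irrefl xy)))
      where
      agree : ∀ {v} → v ≢ x → matchedX M v ≡ matchedX (match M fx fy xy) v
      agree {v} v≢x with v ≟ᶠ y
      ... | yes refl = matchedX-Y M (match M fx fy xy) (X⇒Y cx xy)
      ... | no v≢y = matchedX-cong M (match M fx fy xy) (sym (redirect-other v≢x v≢y))

    reroute : ∀ M {x y x₁} → mate M x ≡ just y → mate M x₁ ≡ nothing → Adj G x₁ y →
      c x ≡ true → c x₁ ≡ true →
      Σ Matching λ M′ → size M′ ≡ size M × mate M′ x ≡ nothing ×
        (∀ {v} → v ≢ x → v ≢ y → v ≢ x₁ → mate M′ v ≡ mate M v)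
    reroute M {x} {y} {x₁} mx fx₁ x₁y cx cx₁ =
      M″ , same-size , trans (redirect-other x≢x₁ x≢y) (redirect-x x≢y) , agree
      where
      x≢y = mate-irrefl M mx
      x₁≢x : x₁ ≢ x
      x₁≢x refl with () ← trans (sym fx₁) mx
      x₁≢y : x₁ ≢ y
      x₁≢y refl with () ← trans (sym cx₁) (X⇒Y cx (mate-adj M mx))
      x≢x₁ = x₁≢x ∘ sym
      M′ = unmatch M mx
      fx₁′ : mate M′ x₁ ≡ nothing
      fx₁′ = trans (redirect-other x₁≢x x₁≢y) fx₁
      fy′ : mate M′ y ≡ nothing
      fy′ = redirect-y
      M″ = match M′ fx₁′ fy′ x₁y
      same-size : size M″ ≡ size M
      same-size = trans (size-match M′ fx₁′ fy′ x₁y cx₁) (sym (size-unmatch M mx cx))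
      agree : ∀ {v} → v ≢ x → v ≢ y → v ≢ x₁ → mate M″ v ≡ mate M v
      agree v≢x v≢y v≢x₁ = trans (redirect-other v≢x₁ v≢y) (redirect-other v≢x v≢y)

    module Alternating (M : Matching) where

      data Reach (Z : Fin n → Bool) (v : Fin n) : Set where
        by-edge : ∀ {x} → c x ≡ true → Z x ≡ true → Adj G x v → Reach Z v
        by-mate : ∀ {y} → mate M v ≡ just y → Z y ≡ true → Reach Z v

      reach? : ∀ Z v → Dec (Reach Z v)
      reach? Z v with any? (λ x → (c x ≟ᵇ true) ×-dec (Z x ≟ᵇ true) ×-dec (adj G x v ≟ᵇ true))
      ... | yes (_ , cx , zx , xv) = yes (by-edge cx zx xv)
      ... | no no-edge with mate M v in mv
      ...   | nothing = no λ { (by-edge cx zx xv) → no-edge (_ , cx , zx , xv)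
                             ; (by-mate mv′ _) → case trans (sym mv) mv′ of λ () }
      ...   | just y with Z y ≟ᵇ true
      ...     | yes zy = yes (by-mate mv zy)
      ...     | no ¬zy = no λ { (by-edge cx zx xv) → no-edge (_ , cx , zx , xv)
                              ; (by-mate mv′ zy′) →
                                  ¬zy (subst (λ w → Z w ≡ true) (just-injective (trans (sym mv′) mv)) zy′) }

      -- The vertices reached from a free X-vertex by an M-alternating path of length ≤ k.
      reached : ℕ → Fin n → Bool
      reached zero v = c v ∧ is-nothing (mate M v)
      reached (suc k) v = reached k v ∨ does (reach? (reached k) v)

      reached-step : ∀ {k v} → reached k v ≡ true → reached (suc k) v ≡ true
      reached-step r rewrite r = refl

      reached-new : ∀ {k v} → Reach (reached k) v → reached (suc k) v ≡ true
      reached-new {k} {v} r rewrite dec-true (reach? (reached k) v) r = ∨-zeroʳ (reached k v)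

      reached-suc⁻ : ∀ {k v} → reached (suc k) v ≡ true →
        reached k v ≡ true ⊎ (reached k v ≢ true × Reach (reached k) v)
      reached-suc⁻ {k} {v} r with reached k v | reach? (reached k) v
      ... | true  | _ = inj₁ refl
      ... | false | yes rv = inj₂ ((λ ()) , rv)
      reached-suc⁻ () | false | no _

      reached-zero⁻ : ∀ {v} → reached zero v ≡ true → c v ≡ true × mate M v ≡ nothing
      reached-zero⁻ {v} r with c v | mate M v
      ... | true | nothing = refl , refl

      reached-free : ∀ {k v} → c v ≡ true → mate M v ≡ nothing → reached k v ≡ true
      reached-free {zero} cv fv rewrite cv | fv = refl
      reached-free {suc k} cv fv = reached-step {k} (reached-free {k} cv fv)

      record Freed (k : ℕ) (x : Fin n) : Set where
        field
          matching  : Matching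
          same-size : size matching ≡ size M
          free      : mate matching x ≡ nothing
          agrees    : ∀ {v} → reached k v ≢ true → mate matching v ≡ mate M v

      open Freed

      weaken : ∀ {k x} → Freed k x → Freed (suc k) x
      weaken {k} F = record
        { matching = matching F ; same-size = same-size F ; free = free F
        ; agrees = λ v∉ → agrees F (v∉ ∘ reached-step {k}) }

      mutual
        free-at : ∀ k {x} → c x ≡ true → reached k x ≡ true → Freed k x
        free-at zero cx zx = record
          { matching = M ; same-size = refl ; free = proj₂ (reached-zero⁻ zx) ; agrees = λ _ → refl }
        free-at (suc k) cx zx with reached-suc⁻ {k} zx
        ... | inj₁ zx′ = weaken (free-at k cx zx′)
        ... | inj₂ (_ , by-edge cx₁ _ x₁x) with () ← trans (sym cx) (X⇒Y cx₁ x₁x)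
        ... | inj₂ (x∉ , by-mate mx zy) = free-via-mate k cx zx x∉ mx zy

        -- x enters level k+1 through its mate y, which enters level k through an edge
        -- from some x₁; free x₁ recursively, then trade the matching edge xy for x₁y.
        free-via-mate : ∀ k {x y} → c x ≡ true → reached (suc k) x ≡ true → reached k x ≢ true →
          mate M x ≡ just y → reached k y ≡ true → Freed (suc k) x
        free-via-mate zero cx _ _ mx zy
          with () ← trans (sym (proj₁ (reached-zero⁻ zy))) (X⇒Y cx (mate-adj M mx))
        free-via-mate (suc k) {x} {y} cx zx x∉ mx zy with reached-suc⁻ {k} zy
        ... | inj₁ zy′ = contradiction (reached-new {k} (by-mate mx zy′)) x∉
        ... | inj₂ (_ , by-mate my zx′) =
          contradiction (reached-step {k} (subst (λ w → reached k w ≡ true) y-mate zx′)) x∉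
          where y-mate = just-injective (trans (sym my) (mate-sym M mx))
        ... | inj₂ (y∉ , by-edge cx₁ zx₁ x₁y)
          with F ← free-at k cx₁ zx₁
          with M′ , same-size′ , free′ , untouched ←
                 reroute (matching F) (trans (agrees F (x∉ ∘ reached-step {k})) mx) (free F) x₁y cx cx₁
          = record
            { matching = M′ ; same-size = trans same-size′ (same-size F)
            ; free = free′ ; agrees = agrees′ }
          where
          agrees′ : ∀ {v} → reached (suc (suc k)) v ≢ true → mate M′ v ≡ mate M v
          agrees′ v∉ = trans
            (untouched (λ { refl → v∉ zx }) (λ { refl → v∉ (reached-step {suc k} zy) })
                       (λ { refl → v∉ (reached-step {suc k} (reached-step {k} zx₁)) }))
            (agrees F (v∉ ∘ reached-step {suc k} ∘ reached-step {k}))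

      augment : ∀ k {y} → c y ≡ false → mate M y ≡ nothing → reached k y ≡ true →
        Σ Matching λ M′ → size M′ ≡ suc (size M)
      augment zero cy _ zy with () ← trans (sym cy) (proj₁ (reached-zero⁻ zy))
      augment (suc k) cy fy zy with reached-suc⁻ {k} zy
      ... | inj₁ zy′ = augment k cy fy zy′
      ... | inj₂ (_ , by-mate my _) with () ← trans (sym fy) my
      ... | inj₂ (y∉ , by-edge cx₁ zx₁ x₁y) =
        match (matching F) (free F) fy′ x₁y ,
        trans (size-match (matching F) (free F) fy′ x₁y cx₁) (cong suc (same-size F))
        where
        F = free-at k cx₁ zx₁
        fy′ = trans (agrees F y∉) fy

      module Fixpoint (j : ℕ) (stable : ∀ {v} → reached (suc j) v ≡ true → reached j v ≡ true)
                      (no-free-Y : ∀ {y} → c y ≡ false → reached j y ≡ true → mate M y ≢ nothing) where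

        edge-closed : ∀ {x y} → c x ≡ true → reached j x ≡ true → Adj G x y → reached j y ≡ true
        edge-closed cx zx xy = stable (reached-new {j} (by-edge cx zx xy))

        mate-closed : ∀ {x y} → mate M x ≡ just y → reached j y ≡ true → reached j x ≡ true
        mate-closed mx zy = stable (reached-new {j} (by-mate mx zy))

        cover : Fin n → Bool
        cover v = if c v then not (reached j v) else reached j v

        cover⁻ : ∀ {v} → cover v ≡ true →
          (c v ≡ true × reached j v ≢ true) ⊎ (c v ≡ false × reached j v ≡ true)
        cover⁻ {v} with c v | reached j v
        ... | true  | false = λ _ → inj₁ (refl , λ ())
        ... | false | true  = λ _ → inj₂ (refl , refl)
        ... | true  | true  = λ ()
        ... | false | false = λ ()

        cover-edge-X : ∀ {u v} → c u ≡ true → Adj G u v → cover u ≡ true ⊎ cover v ≡ true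
        cover-edge-X {u} cu uv with reached j u in zu
        ... | true rewrite X⇒Y cu uv | edge-closed cu zu uv = inj₂ refl
        ... | false rewrite cu = inj₁ refl

        cover-edge : ∀ {u v} → Adj G u v → cover u ≡ true ⊎ cover v ≡ true
        cover-edge {u} uv with c u ≟ᵇ true
        ... | yes cu = cover-edge-X cu uv
        ... | no ¬cu = swap (cover-edge-X (Y⇒X (¬-not ¬cu) uv) (Adj-sym uv))

        uncovered : List (Fin n)
        uncovered = filter (λ v → ¬? (cover v ≟ᵇ true)) (allFin n)

        uncovered-independent : IsIndependent G uncovered
        uncovered-independent = distinct , AllPairs-∈⁺ distinct λ u∈ v∈ _ uv →
          [ uncovered⁻ u∈ , uncovered⁻ v∈ ] (cover-edge uv)
          where
          distinct = Uniqueₚ.filter⁺ _ (Uniqueₚ.allFin⁺ n)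
          uncovered⁻ : ∀ {v} → v ∈ uncovered → cover v ≢ true
          uncovered⁻ = proj₂ ∘ ∈-filter⁻ (λ v → ¬? (cover v ≟ᵇ true)) {xs = allFin n}

        Y-mate : ∀ {y} → c y ≡ false → reached j y ≡ true → mate M y ≡ just (partner M y)
        Y-mate cy zy = mate-partner M (no-free-Y cy zy)

        -- Distinct cover vertices lie on distinct matching edges, named by their X-ends.
        witness : Fin n → Fin n
        witness v = if c v then v else partner M v

        witness-matched : ∀ {v} → cover v ≡ true → matchedX M (witness v) ≡ true
        witness-matched cov with cover⁻ cov
        ... | inj₁ (cv , ¬zv) rewrite cv = matchedX⁺ M cv (mate-partner M (¬zv ∘ reached-free {j} cv))
        ... | inj₂ (cv , zv) rewrite cv =
          matchedX⁺ M (Y⇒X cv (mate-adj M (Y-mate cv zv))) (mate-sym M (Y-mate cv zv))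

        private
          crossed : ∀ {x y} → reached j x ≢ true → c y ≡ false → reached j y ≡ true →
            x ≢ partner M y
          crossed ¬zx cy zy refl = ¬zx (mate-closed (mate-sym M (Y-mate cy zy)) zy)

        witness-injective : ∀ {v w} → cover v ≡ true → cover w ≡ true →
          witness v ≡ witness w → v ≡ w
        witness-injective cov cow with cover⁻ cov | cover⁻ cow
        ... | inj₁ (cv , _) | inj₁ (cw , _) rewrite cv | cw = λ v≡w → v≡w
        ... | inj₁ (cv , ¬zv) | inj₂ (cw , zw) rewrite cv | cw =
          λ eq → contradiction eq (crossed ¬zv cw zw)
        ... | inj₂ (cv , zv) | inj₁ (cw , ¬zw) rewrite cv | cw =
          λ eq → contradiction (sym eq) (crossed ¬zw cv zv)
        ... | inj₂ (cv , zv) | inj₂ (cw , zw) rewrite cv | cw =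
          partner-injective M (Y-mate cv zv) (Y-mate cw zw)

        koenig-bound : ∀ a → (∀ I → IsIndependent G I → length I ≤ a) → n ≤ a + size M
        koenig-bound a α-max = begin
          n                            ≡⟨ length-tabulate _ ⟨
          length (allFin n)            ≡⟨ length-filter-∁ (λ v → cover v ≟ᵇ true) (allFin n) ⟨
          ∣ cover ∣ + length uncovered ≡⟨ +-comm ∣ cover ∣ _ ⟩
          length uncovered + ∣ cover ∣ ≤⟨ +-mono-≤ (α-max _ uncovered-independent) cover≤size ⟩
          a + size M                   ∎
          where
          open ≤-Reasoning
          cover≤size : ∣ cover ∣ ≤ size M
          cover≤size = length≤-injection _≟ᶠ_ witness (elements-unique cover)
            (∈-elements⁺ ∘ witness-matched ∘ ∈-elements⁻)
            (λ v∈ w∈ → witness-injective (∈-elements⁻ v∈) (∈-elements⁻ w∈))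

      augment-or-bound : ∀ a → (∀ I → IsIndependent G I → length I ≤ a) →
        (Σ Matching λ M′ → size M′ ≡ suc (size M)) ⊎ n ≤ a + size M
      augment-or-bound a α-max
        with j , stable ← stabilises reached (λ {k} → reached-step {k})
        with any? (λ y → (c y ≟ᵇ false) ×-dec (reached j y ≟ᵇ true)
                           ×-dec ≡-decᵐ _≟ᶠ_ (mate M y) nothing)
      ... | yes (_ , cy , zy , fy) = inj₁ (augment j cy fy zy)
      ... | no none = inj₂ (Fixpoint.koenig-bound j stable (λ cy zy fy → none (_ , cy , zy , fy)) a α-max)

    koenig : ∀ a → (∀ I → IsIndependent G I → length I ≤ a) → Σ Matching λ M → n ≤ a + size M
    koenig a α-max = improve n empty (m≤m+n n _)
      where
      improve : ∀ slack M → n ≤ slack + size M → Σ Matching λ M → n ≤ a + size M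
      improve slack M n≤ with Alternating.augment-or-bound M a α-max
      ... | inj₂ bound = M , bound
      ... | inj₁ (M′ , grew) with slack
      ...   | zero = contradiction (subst (_≤ n) grew (∣∣≤n (matchedX M′))) (<⇒≱ (s≤s n≤))
      ...   | suc slack′ =
        improve slack′ M′ (subst (n ≤_) (trans (sym (+-suc slack′ _)) (cong (slack′ +_) (sym grew))) n≤)

    module _ (M : Matching) {T : List (Fin n)} (closed : Closed M T) where

      matched-inside matched-outside : List (Fin n)
      matched-inside = filter (_∈? T) (elements (matchedX M))
      matched-outside = filter (λ v → ¬? (v ∈? T)) (elements (matchedX M))

      size-split : length matched-inside + length matched-outside ≡ size M
      size-split = length-filter-∁ (_∈? T) (elements (matchedX M))

      private
        inside⁻ : ∀ {x} → x ∈ matched-inside →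
          x ∈ T × c x ≡ true × mate M x ≡ just (partner M x)
        inside⁻ x∈ with x∈M , x∈T ← ∈-filter⁻ (_∈? T) {xs = elements (matchedX M)} x∈ =
          x∈T , matchedX⁻ M (∈-elements⁻ x∈M)

        outside⁻ : ∀ {x} → x ∈ matched-outside →
          x ∉ T × c x ≡ true × mate M x ≡ just (partner M x)
        outside⁻ x∈
          with x∈M , x∉T ← ∈-filter⁻ (λ v → ¬? (v ∈? T)) {xs = elements (matchedX M)} x∈ =
          x∉T , matchedX⁻ M (∈-elements⁻ x∈M)

      matched-inside-double : length matched-inside + length matched-inside ≤ length T
      matched-inside-double = subst (_≤ length T) length-eq (Unique⇒length≤ _≟ᶠ_ distinct ⊆T)
        where
        inside-unique : Unique matched-inside
        inside-unique = Uniqueₚ.filter⁺ (_∈? T) (elements-unique (matchedX M))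
        mate-of : ∀ {x} → x ∈ matched-inside → mate M x ≡ just (partner M x)
        mate-of = proj₂ ∘ proj₂ ∘ inside⁻
        disjoint : ∀ {v} → ¬ (v ∈ matched-inside × v ∈ map (partner M) matched-inside)
        disjoint (v∈ , v∈map) with z , z∈ , refl ← ∈-map⁻ (partner M) v∈map
          with _ , cz , mz ← inside⁻ z∈ | _ , cv , _ ← inside⁻ v∈ = X≢partner M cv cz mz refl
        distinct : Unique (matched-inside ++ map (partner M) matched-inside)
        distinct = Uniqueₚ.++⁺ inside-unique
          (Unique-map⁺ (partner M) inside-unique λ x∈ y∈ → partner-injective M (mate-of x∈) (mate-of y∈))
          disjoint
        ⊆T : matched-inside ++ map (partner M) matched-inside ⊆ T
        ⊆T v∈ with ∈-++⁻ matched-inside v∈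
        ... | inj₁ v∈in = proj₁ (inside⁻ v∈in)
        ... | inj₂ v∈map with x , x∈ , refl ← ∈-map⁻ (partner M) v∈map =
          closed (proj₁ (inside⁻ x∈)) (mate-of x∈)
        length-eq : length (matched-inside ++ map (partner M) matched-inside) ≡
                    length matched-inside + length matched-inside
        length-eq = trans (length-++ matched-inside)
                          (cong (length matched-inside +_) (length-map (partner M) matched-inside))

      module _ {J : List (Fin n)} (J-indep : IsIndependent G J) where

        -- An end of x's matching edge outside the independent set J.
        avoid : Fin n → Fin n
        avoid x with x ∈? J
        ... | yes _ = partner M x
        ... | no _  = x

        avoid-view : ∀ x → (x ∉ J × avoid x ≡ x) ⊎ (x ∈ J × avoid x ≡ partner M x)
        avoid-view x with x ∈? J
        ... | yes x∈ = inj₂ (x∈ , refl)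
        ... | no x∉  = inj₁ (x∉ , refl)

        avoid-∉J : ∀ {x} → mate M x ≡ just (partner M x) → avoid x ∉ J
        avoid-∉J {x} mx v∈ with avoid-view x
        ... | inj₁ (x∉ , eq) = x∉ (subst (_∈ J) eq v∈)
        ... | inj₂ (x∈ , eq) = independent-∈ J-indep x∈ (subst (_∈ J) eq v∈) (mate-adj M mx)

        avoid-injective : ∀ {x y} → c x ≡ true → mate M x ≡ just (partner M x) →
          c y ≡ true → mate M y ≡ just (partner M y) → avoid x ≡ avoid y → x ≡ y
        avoid-injective {x} {y} cx mx cy my eq with avoid-view x | avoid-view y
        ... | inj₁ (_ , ex) | inj₁ (_ , ey) = trans (sym ex) (trans eq ey)
        ... | inj₂ (_ , ex) | inj₂ (_ , ey) = partner-injective M mx my (trans (sym ex) (trans eq ey))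
        ... | inj₁ (_ , ex) | inj₂ (_ , ey) =
          contradiction (trans (sym ex) (trans eq ey)) (X≢partner M cx cy my)
        ... | inj₂ (_ , ex) | inj₁ (_ , ey) =
          contradiction (trans (sym ey) (trans (sym eq) ex)) (X≢partner M cy cx mx)

        outside-bound : Unique T → All (_∉ T) J → length J + length matched-outside + length T ≤ n
        outside-bound T-unique J∉T = begin
          length J + length matched-outside + length T ≡⟨ length-eq ⟨
          length ((J ++ E) ++ T)
            ≤⟨ Unique⇒length≤ _≟ᶠ_ distinct (λ {v} _ → ∈-allFin v) ⟩
          length (allFin n)                            ≡⟨ length-tabulate _ ⟩
          n                                            ∎
          where
          open ≤-Reasoning
          E = map avoid matched-outside
          outside-unique = Uniqueₚ.filter⁺ (λ v → ¬? (v ∈? T)) (elements-unique (matchedX M))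
          E-unique : Unique E
          E-unique = Unique-map⁺ avoid outside-unique λ x∈ y∈ →
            let _ , cx , mx = outside⁻ x∈ ; _ , cy , my = outside⁻ y∈ in avoid-injective cx mx cy my
          E⁻ : ∀ {v} → v ∈ E → ∃ λ x → x ∈ matched-outside × v ≡ avoid x
          E⁻ = ∈-map⁻ avoid
          J∩E : ∀ {v} → ¬ (v ∈ J × v ∈ E)
          J∩E (v∈J , v∈E) with x , x∈ , refl ← E⁻ v∈E
                          with _ , _ , mx ← outside⁻ x∈ = avoid-∉J mx v∈J
          JE∩T : ∀ {v} → ¬ (v ∈ J ++ E × v ∈ T)
          JE∩T (v∈ , v∈T) with ∈-++⁻ J v∈
          ... | inj₁ v∈J = All.lookup J∉T v∈J v∈T
          ... | inj₂ v∈E with x , x∈ , refl ← E⁻ v∈E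
                           with x∉T , _ , mx ← outside⁻ x∈
                           with avoid-view x
          ...   | inj₁ (_ , eq) = x∉T (subst (_∈ T) eq v∈T)
          ...   | inj₂ (_ , eq) = x∉T (closed (subst (_∈ T) eq v∈T) (mate-sym M mx))
          distinct : Unique ((J ++ E) ++ T)
          distinct = Uniqueₚ.++⁺ (Uniqueₚ.++⁺ (proj₁ J-indep) E-unique J∩E) T-unique JE∩T
          length-eq : length ((J ++ E) ++ T) ≡ length J + length matched-outside + length T
          length-eq = begin-equality
            length ((J ++ E) ++ T)          ≡⟨ length-++ (J ++ E) ⟩
            length (J ++ E) + length T      ≡⟨ cong (_+ length T) (length-++ J) ⟩
            length J + length E + length T
              ≡⟨ cong (λ m → length J + m + length T) (length-map avoid matched-outside) ⟩
            length J + length matched-outside + length T ∎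

    contraction-bound : ∀ M {r} (t : RootedTree r) → Closed M (vertices t) → ∀ a d →
      n ≤ a + size M → suc (d + d) ≤ length (vertices t) → ContrIndepNum≤ G (edges t) (a ∸ d)
    contraction-bound M t closed a d n≤ 2d<|T| I I-indep = m+n≤o⇒m≤o∸n (length I) (begin
      length I + d          ≤⟨ +-monoˡ-≤ d (ContrIndependent-component I-indep same-component) ⟩
      suc (length I∖T + d)  ≤⟨ +-cancelʳ-≤ (mi + mo) _ _ count ⟩
      a                     ∎)
      where
      open ≤-Reasoning
      T = vertices t
      I∖T = filter (λ v → ¬? (v ∈? T)) I
      mi = length (matched-inside M closed)
      mo = length (matched-outside M closed)

      same-component : ∀ {x y} → x ∈ T → y ∈ T → SameComp G (edges t) x y
      same-component x∈ y∈ = SameComp-trans (SameComp-sym (spans t x∈)) (spans t y∈)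

      I∖T-independent : IsIndependent G I∖T
      I∖T-independent with distinct , ¬adj ← ContrIndependent⇒Independent I-indep =
        Uniqueₚ.filter⁺ _ distinct , AllPairsₚ.filter⁺ _ ¬adj

      I∖T-outside : All (_∉ T) I∖T
      I∖T-outside = All.tabulate (proj₂ ∘ ∈-filter⁻ (λ v → ¬? (v ∈? T)) {xs = I})

      d+mi<|T| : d + mi < length T
      d+mi<|T| = half-sum< mi d (matched-inside-double M closed) 2d<|T|

      rearrange : ∀ j d mi mo → suc (j + d) + (mi + mo) ≡ j + mo + suc (d + mi)
      rearrange = solve-∀

      count : suc (length I∖T + d) + (mi + mo) ≤ a + (mi + mo)
      count = begin
        suc (length I∖T + d) + (mi + mo)  ≡⟨ rearrange (length I∖T) d mi mo ⟩
        length I∖T + mo + suc (d + mi)    ≤⟨ +-monoʳ-≤ (length I∖T + mo) d+mi<|T| ⟩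
        length I∖T + mo + length T        ≤⟨ outside-bound M closed I∖T-independent (unique t) I∖T-outside ⟩
        n                                 ≤⟨ n≤ ⟩
        a + size M                        ≡⟨ cong (a +_) (size-split M closed) ⟨
        a + (mi + mo)                     ∎

theorem5 : (d : ℕ) → 1 ≤ d → (n : ℕ) → (G : Graph n) →
    Connected G → Bipartite G → 2 * d + 2 ≤ n →
    (a : ℕ) → IsIndepNum G a → d + 1 ≤ a →
    Σ (EdgeList G) λ S → IsEdgeSet G S × length S ≤ 2 * d + 1 × ContrIndepNum≤ G S (a ∸ d)
theorem5 d _ zero G _ _ 2d+2≤0 _ _ _ = contradiction (m+n≤o⇒n≤o (2 * d) 2d+2≤0) λ ()
theorem5 d _ (suc n) G connected (c , proper) 2d+2≤n a (_ , α-max) _ =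
  let open Bipartite G c proper
      M , n≤a+|M| = koenig a α-max
      t , closed , 2d<|T| , |T|≤2d+2 = grow G M connected Fin.zero (d + d) 2d<n
  in edges t , edges-valid t , subst (length (edges t) ≤_) (sym (double+1 d)) (edges≤ G t |T|≤2d+2) ,
     contraction-bound M t closed a d n≤a+|M| 2d<|T|
  where
  double+1 : ∀ d → 2 * d + 1 ≡ suc (d + d)
  double+1 = solve-∀
  double+2 : ∀ d → 2 * d + 2 ≡ suc (suc (d + d))
  double+2 = solve-∀
  2d<n : suc (d + d) ≤ suc n
  2d<n = ≤-trans (n≤1+n _) (subst (_≤ suc n) (double+2 d) 2d+2≤n)
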